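{- Let $a,b$ be positive integers and let $(x_0,y_0),(x_1,y_1),\dots$ be the P-positions $(x,y)$ of $\mathrm{WYT}(a,b)$ with $x\le y$, listed so that $x_0<x_1<\cdots$. Then $\mathcal{R}(x_m,y_m)=2m$ for all $m\in\mathbb{Z}_+$.
   Context: Game $\mathrm{WYT}(a,b)$: positions are pairs $(x,y)$ of nonnegative integers; a move replaces $(x,y)$ by $(x-\epsilon,y-\delta)$ where $0\le\epsilon\le x$, $0\le\delta\le y$, $\epsilon+\delta>0$, and $|\epsilon-\delta|<a$ or $\min(\epsilon,\delta)<b$ (or both). A player unable to move loses. P-positions are those from which the player to move loses under optimal play. For each P-position with $x\le y$ the first coordinates are distinct and $(x_0,y_0)=(0,0)$. Remoteness function: $\mathcal{R}(p)=0$ if $p$ is terminal; otherwise, if some move $p\to q$ has $\mathcal{R}(q)$ even, $\mathcal{R}(p)=1+\min\{\mathcal{R}(q): p\to q,\ \mathcal{R}(q)\text{ even}\}$, else $\mathcal{R}(p)=1+\max\{\mathcal{R}(q): p\to q\}$. -}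

module Defs where

open import Data.Nat using (ℕ; zero; suc; _+_; _*_; _∸_; _≤_; _<_; _⊓_; _⊔_; ∣_-_∣; _<ᵇ_; _≡ᵇ_; _%_)
open import Data.Bool using (Bool; true; false; _∨_; _∧_; if_then_else_)
open import Data.List using (List; []; _∷_; map; concatMap; upTo; foldr; filterᵇ)
open import Data.Maybe using (Maybe; just; nothing; maybe)
open import Data.Product using (_×_; _,_; proj₁; proj₂)
open import Data.Sum using (_⊎_)
open import Relation.Binary.PropositionalEquality using (_≡_)

Pos : Set
Pos = ℕ × ℕ

record Move (a b : ℕ) (p q : Pos) : Set where
  constructor move
  field
    ε δ    : ℕ
    ε≤x    : ε ≤ proj₁ p
    δ≤y    : δ ≤ proj₂ p
    pos    : 0 < ε + δ
    rule   : (∣ ε - δ ∣ < a) ⊎ (ε ⊓ δ < b)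
    target : q ≡ (proj₁ p ∸ ε , proj₂ p ∸ δ)

data IsP (a b : ℕ) (p : Pos) : Set
data IsN (a b : ℕ) (p : Pos) : Set

data IsP a b p where
  isP : (∀ q → Move a b p q → IsN a b q) → IsP a b p

data IsN a b p where
  isN : ∀ q → Move a b p q → IsP a b q → IsN a b p

legal : ℕ → ℕ → ℕ × ℕ → Bool
legal a b (e , d) = (0 <ᵇ e + d) ∧ ((∣ e - d ∣ <ᵇ a) ∨ ((e ⊓ d) <ᵇ b))

moves : ℕ → ℕ → Pos → List Pos
moves a b (x , y) =
  map (λ ed → (x ∸ proj₁ ed , y ∸ proj₂ ed))
      (filterᵇ (legal a b)
         (concatMap (λ e → map (λ d → (e , d)) (upTo (suc y))) (upTo (suc x))))

isEven : ℕ → Bool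
isEven r = r % 2 ≡ᵇ 0

minEven : List ℕ → Maybe ℕ
minEven = foldr (λ r acc → if isEven r then just (maybe (r ⊓_) r acc) else acc) nothing

maxList : List ℕ → ℕ
maxList = foldr _⊔_ 0

-- Remoteness of a position given the remoteness values of its options:
-- 0 if terminal; 1 + least even option value if one exists; else 1 + max.
combine : List ℕ → ℕ
combine [] = 0
combine (r ∷ rs) with minEven (r ∷ rs)
... | just m  = suc m
... | nothing = suc (maxList (r ∷ rs))

-- Fuelled remoteness; each move strictly decreases x + y, so fuel x + y + 1
-- suffices for the recursion to reach all terminal positions.
remF : ℕ → ℕ → ℕ → Pos → ℕ
remF a b zero    p = 0
remF a b (suc k) p = combine (map (remF a b k) (moves a b p))

Rem : ℕ → ℕ → Pos → ℕ
Rem a b (x , y) = remF a b (suc (x + y)) (x , y)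

-- The P-positions lie on the lines y = x + a n: by strong induction y_n − x_n = a n, since a smaller
-- gap would make f n reachable from an earlier P-position f k (k = ⌊(y_n − x_n)/a⌋), and a larger one
-- would leave (x_n, x_n + a n) neither P (it lies straight below f n) nor N (P-positions of smaller
-- index are too far from it). Consequently, from (x_m, y_m) every option is an N-position that can
-- reach some P-position of smaller index, whereas the option (x_{m−1}, y_m) can only reach P-positions
-- of index ≥ m − 1. Induction on m then pins the remoteness of the m-th P-position to 2m: its options
-- have odd remoteness at most 2m − 1, and the option (x_{m−1}, y_m) attains 2m − 1.
module Submission where

open import Defs
open import Data.Bool using (true; false; not; T)
open import Data.Bool.Properties using (not-involutive; T?; T-∧; T-∨)
open import Data.Empty using (⊥; ⊥-elim)
open import Data.List using (List; []; _∷_; _++_; map; upTo; concatMap; cartesianProduct)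
open import Data.List.Membership.Propositional using (_∈_)
open import Data.List.Membership.Propositional.Properties
  using ( ∈-map⁺; ∈-map⁻; ∈-map∘filter⁺; ∈-map∘filter⁻
        ; ∈-cartesianProduct⁺; ∈-cartesianProduct⁻; ∈-upTo⁺; ∈-upTo⁻)
open import Data.List.Properties using (map-cong-local)
open import Data.List.Relation.Unary.All as All using (All; []; _∷_)
open import Data.List.Relation.Unary.All.Properties using (map⁺)
open import Data.List.Relation.Unary.Any using (here; there)
open import Data.Maybe using (just; nothing)
open import Data.Nat
open import Data.Nat.DivMod using (_/_; _%_; m≡m%n+[m/n]*n; m%n<n; m<n*o⇒m/o<n)
open import Data.Nat.Induction using (<-rec; <-wellFounded)
open import Data.Nat.Properties
open import Data.Nat.Tactic.RingSolver using (solve-∀)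
open import Data.Product using (_×_; _,_; proj₁; proj₂; ∃; swap)
open import Data.Sum as Sum using (_⊎_; inj₁; inj₂)
open import Function using (_∘_)
open import Function.Bundles using (Equivalence)
open import Induction.WellFounded as WF using ()
open import Relation.Nullary using (¬_; yes; no)
open import Relation.Binary using (tri<; tri≈; tri>)
open import Relation.Binary.Construct.On using (wellFounded)
open import Relation.Binary.PropositionalEquality
open import Algebra.Properties.CommutativeSemigroup +-commutativeSemigroup using (interchange)

Even Odd : ℕ → Set
Even n = isEven n ≡ true
Odd n = isEven n ≡ false

Even⇒¬Odd : ∀ {n} → Even n → ¬ Odd n
Even⇒¬Odd e o with () ← trans (sym e) o

isEven-suc : ∀ n → isEven (suc n) ≡ not (isEven n)
isEven-suc zero = refl
isEven-suc (suc n) = sym (trans (cong not (isEven-suc n)) (not-involutive (isEven n)))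

Even⇒suc-Odd : ∀ {n} → Even n → Odd (suc n)
Even⇒suc-Odd {n} e = trans (isEven-suc n) (cong not e)

Odd⇒suc-Even : ∀ {n} → Odd n → Even (suc n)
Odd⇒suc-Even {n} o = trans (isEven-suc n) (cong not o)

maxList-∈ : ∀ r rs → maxList (r ∷ rs) ∈ r ∷ rs
maxList-∈ r [] rewrite ⊔-identityʳ r = here refl
maxList-∈ r (s ∷ rs) with ⊔-sel r (maxList (s ∷ rs))
... | inj₁ r⊔m≡r rewrite r⊔m≡r = here refl
... | inj₂ r⊔m≡m rewrite r⊔m≡m = there (maxList-∈ s rs)

maxList-upper : ∀ {r} l → r ∈ l → r ≤ maxList l
maxList-upper (s ∷ l) (here refl) = m≤m⊔n s (maxList l)
maxList-upper (s ∷ l) (there r∈l) = ≤-trans (maxList-upper l r∈l) (m≤n⊔m s (maxList l))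

LeastEven : ℕ → List ℕ → Set
LeastEven m l = m ∈ l × Even m × All (λ r → Even r → m ≤ r) l

minEven-spec : ∀ l → (minEven l ≡ nothing × All Odd l)
                   ⊎ (∃ λ m → minEven l ≡ just m × LeastEven m l)
minEven-spec [] = inj₁ (refl , [])
minEven-spec (r ∷ rs) with isEven r in r-parity | minEven-spec rs
... | false | inj₁ (≡nothing , odd) = inj₁ (≡nothing , r-parity ∷ odd)
... | false | inj₂ (m , ≡just , m∈ , even , least) =
  inj₂ (m , ≡just , there m∈ , even , (λ e → ⊥-elim (Even⇒¬Odd {r} e r-parity)) ∷ least)
... | true | inj₁ (≡nothing , odd) rewrite ≡nothing =
  inj₂ (r , refl , here refl , r-parity ,
        (λ _ → ≤-refl) ∷ All.map (λ {s} o e → ⊥-elim (Even⇒¬Odd {s} e o)) odd)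
... | true | inj₂ (m , ≡just , m∈ , even , least) rewrite ≡just =
  let r⊓m∈ , r⊓m-even = selected in
  inj₂ (r ⊓ m , refl , r⊓m∈ , r⊓m-even ,
        (λ _ → m⊓n≤m r m) ∷ All.map (λ m≤ e → ≤-trans (m⊓n≤n r m) (m≤ e)) least)
  where
  selected : r ⊓ m ∈ r ∷ rs × Even (r ⊓ m)
  selected with ⊓-sel r m
  ... | inj₁ r⊓m≡r rewrite r⊓m≡r = here refl , r-parity
  ... | inj₂ r⊓m≡m rewrite r⊓m≡m = there m∈ , even

combine-odd : ∀ {r rs} → All Odd (r ∷ rs) → combine (r ∷ rs) ≡ suc (maxList (r ∷ rs))
combine-odd {r} {rs} odd with minEven (r ∷ rs) | minEven-spec (r ∷ rs)
... | nothing | _ = refl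
... | just _ | inj₂ (m , _ , m∈ , even , _) = ⊥-elim (Even⇒¬Odd {m} even (All.lookup odd m∈))

combine-even : ∀ {r l} → r ∈ l → Even r → ∃ λ m → combine l ≡ suc m × LeastEven m l
combine-even {r} {s ∷ l} r∈ even with minEven (s ∷ l) | minEven-spec (s ∷ l)
... | just m | inj₂ (_ , refl , least) = m , refl , least
... | nothing | inj₁ (_ , odd) = ⊥-elim (Even⇒¬Odd {r} even (All.lookup odd r∈))

combine-odd-Even : ∀ {l} → All Odd l → Even (combine l)
combine-odd-Even [] = refl
combine-odd-Even {r ∷ rs} odd rewrite combine-odd odd =
  Odd⇒suc-Even {maxList (r ∷ rs)} (All.lookup odd (maxList-∈ r rs))

combine-even-Odd : ∀ {r l} → r ∈ l → Even r → Odd (combine l)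
combine-even-Odd r∈ even with combine-even r∈ even
... | m , ≡suc , _ , even-m , _ rewrite ≡suc = Even⇒suc-Odd {m} even-m

combine-odd-≤ : ∀ {l k} → All Odd l → All (λ r → suc r ≤ k) l → combine l ≤ k
combine-odd-≤ [] _ = z≤n
combine-odd-≤ {r ∷ rs} odd bounded rewrite combine-odd odd = All.lookup bounded (maxList-∈ r rs)

combine-odd-≥ : ∀ {r l} → All Odd l → r ∈ l → suc r ≤ combine l
combine-odd-≥ {l = s ∷ l} odd r∈ rewrite combine-odd odd = s≤s (maxList-upper (s ∷ l) r∈)

combine-even-≤ : ∀ {r l} → r ∈ l → Even r → combine l ≤ suc r
combine-even-≤ r∈ even with combine-even r∈ even
... | m , ≡suc , _ , _ , least rewrite ≡suc = s≤s (All.lookup least r∈ even)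

∸-gap : ∀ {x y u v} k → u ≤ x → v ≤ y → x + k + v ≤ y + u → (x ∸ u) + k ≤ y ∸ v
∸-gap {x} {y} {u} {v} k u≤x v≤y le = m+n≤o⇒m≤o∸n ((x ∸ u) + k) (+-cancelʳ-≤ u _ _ (begin
  (x ∸ u) + k + v + u ≡⟨ shuffle (x ∸ u) k v u ⟩
  (x ∸ u) + u + k + v ≡⟨ cong (λ t → t + k + v) (m∸n+n≡m u≤x) ⟩
  x + k + v           ≤⟨ le ⟩
  y + u               ∎))
  where
  open ≤-Reasoning
  shuffle : ∀ w k v u → w + k + v + u ≡ w + u + k + v
  shuffle = solve-∀

size : Pos → ℕ
size (x , y) = x + y

infix 4 _⊏_
_⊏_ : Pos → Pos → Set
q ⊏ p = proj₁ q ≤ proj₁ p × proj₂ q ≤ proj₂ p × size q < size p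

⊏-trans : ∀ {r q p} → r ⊏ q → q ⊏ p → r ⊏ p
⊏-trans (r₁≤q₁ , r₂≤q₂ , r<q) (q₁≤p₁ , q₂≤p₂ , q<p) =
  ≤-trans r₁≤q₁ q₁≤p₁ , ≤-trans r₂≤q₂ q₂≤p₂ , <-trans r<q q<p

P-or-all-Q : ∀ {A : Set} {P Q : A → Set} l → (∀ {x} → x ∈ l → P x ⊎ Q x)
           → (∃ λ x → x ∈ l × P x) ⊎ All Q l
P-or-all-Q [] _ = inj₂ []
P-or-all-Q (x ∷ l) decide with decide (here refl) | P-or-all-Q l (decide ∘ there)
... | inj₁ px | _ = inj₁ (x , here refl , px)
... | inj₂ _ | inj₁ (y , y∈l , py) = inj₁ (y , there y∈l , py)
... | inj₂ qx | inj₂ all-q = inj₂ (qx ∷ all-q)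

decrementPairs : ℕ → ℕ → List (ℕ × ℕ)
decrementPairs x y = concatMap (λ e → map (e ,_) (upTo (suc y))) (upTo (suc x))

concatMap≡cartesianProduct : ∀ {A B : Set} (xs : List A) (ys : List B) →
                             concatMap (λ x → map (x ,_) ys) xs ≡ cartesianProduct xs ys
concatMap≡cartesianProduct [] ys = refl
concatMap≡cartesianProduct (x ∷ xs) ys = cong (map (x ,_) ys ++_) (concatMap≡cartesianProduct xs ys)

module WYT (a b : ℕ) where

  Allowed : ℕ → ℕ → Set
  Allowed e d = (∣ e - d ∣ < a) ⊎ (e ⊓ d < b)

  legal⁻ : ∀ e d → T (legal a b (e , d)) → 0 < e + d × Allowed e d
  legal⁻ e d t with Equivalence.to T-∧ t
  ... | pos , allowed = <ᵇ⇒< 0 (e + d) pos , Sum.map (<ᵇ⇒< _ _) (<ᵇ⇒< _ _) (Equivalence.to T-∨ allowed)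

  legal⁺ : ∀ {e d} → 0 < e + d → Allowed e d → T (legal a b (e , d))
  legal⁺ pos allowed = Equivalence.from T-∧ (<⇒<ᵇ pos , Equivalence.from T-∨ (Sum.map <⇒<ᵇ <⇒<ᵇ allowed))

  Move⇒⊏ : ∀ {p q} → Move a b p q → q ⊏ p
  Move⇒⊏ {x , y} (move ε δ ε≤x δ≤y pos _ refl) = m∸n≤m x ε , m∸n≤m y δ , (begin-strict
    (x ∸ ε) + (y ∸ δ)           <⟨ m<m+n _ pos ⟩
    (x ∸ ε) + (y ∸ δ) + (ε + δ) ≡⟨ interchange (x ∸ ε) (y ∸ δ) ε δ ⟩
    (x ∸ ε + ε) + (y ∸ δ + δ)   ≡⟨ cong₂ _+_ (m∸n+n≡m ε≤x) (m∸n+n≡m δ≤y) ⟩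
    x + y                       ∎)
    where open ≤-Reasoning

  Move⇒Allowed : ∀ {p q} → Move a b p q → Allowed (proj₁ p ∸ proj₁ q) (proj₂ p ∸ proj₂ q)
  Move⇒Allowed (move ε δ ε≤x δ≤y _ allowed refl) rewrite m∸[m∸n]≡n ε≤x | m∸[m∸n]≡n δ≤y = allowed

  Allowed⇒Move : ∀ {p q} → q ⊏ p → Allowed (proj₁ p ∸ proj₁ q) (proj₂ p ∸ proj₂ q) → Move a b p q
  Allowed⇒Move {x , y} {u , v} (u≤x , v≤y , q<p) allowed =
    move (x ∸ u) (y ∸ v) (m∸n≤m x u) (m∸n≤m y v) pos allowed
      (cong₂ _,_ (sym (m∸[m∸n]≡n u≤x)) (sym (m∸[m∸n]≡n v≤y)))
    where
    open ≤-Reasoning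
    pos : 0 < (x ∸ u) + (y ∸ v)
    pos = +-cancelˡ-< (u + v) 0 _ (begin-strict
      u + v + 0                   ≡⟨ +-identityʳ (u + v) ⟩
      u + v                       <⟨ q<p ⟩
      x + y                       ≡⟨ cong₂ _+_ (m+[n∸m]≡n u≤x) (m+[n∸m]≡n v≤y) ⟨
      (u + (x ∸ u)) + (v + (y ∸ v)) ≡⟨ interchange u (x ∸ u) v (y ∸ v) ⟩
      u + v + ((x ∸ u) + (y ∸ v)) ∎)

  ∈moves⇒Move : ∀ p {q} → q ∈ moves a b p → Move a b p q
  ∈moves⇒Move (x , y) q∈
    with ∈-map∘filter⁻ (λ (e , d) → x ∸ e , y ∸ d) (T? ∘ legal a b) {xs = decrementPairs x y} q∈
  ... | (e , d) , ed∈ , refl , is-legal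
      with e∈ , d∈ ← ∈-cartesianProduct⁻ (upTo (suc x)) (upTo (suc y))
                       (subst ((e , d) ∈_) (concatMap≡cartesianProduct (upTo (suc x)) (upTo (suc y))) ed∈)
         | pos , allowed ← legal⁻ e d is-legal
         = move e d (≤-pred (∈-upTo⁻ e∈)) (≤-pred (∈-upTo⁻ d∈)) pos allowed refl

  Move⇒∈moves : ∀ {p q} → Move a b p q → q ∈ moves a b p
  Move⇒∈moves {x , y} (move ε δ ε≤x δ≤y pos allowed refl) =
    ∈-map∘filter⁺ (λ (e , d) → x ∸ e , y ∸ d) (T? ∘ legal a b) {xs = decrementPairs x y}
      ((ε , δ) , ed∈ , refl , legal⁺ pos allowed)
    where
    ed∈ = subst ((ε , δ) ∈_) (sym (concatMap≡cartesianProduct (upTo (suc x)) (upTo (suc y))))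
            (∈-cartesianProduct⁺ (∈-upTo⁺ (s≤s ε≤x)) (∈-upTo⁺ (s≤s δ≤y)))

  ∈moves⇒size< : ∀ p {q} → q ∈ moves a b p → size q < size p
  ∈moves⇒size< p = proj₂ ∘ proj₂ ∘ Move⇒⊏ ∘ ∈moves⇒Move p

  Move-swap : ∀ {p q} → Move a b p q → Move a b (swap p) (swap q)
  Move-swap (move ε δ ε≤x δ≤y pos allowed refl) =
    move δ ε δ≤y ε≤x (subst (0 <_) (+-comm ε δ) pos)
      (Sum.map (subst (_< a) (∣-∣-comm ε δ)) (subst (_< b) (⊓-comm ε δ)) allowed) refl

  IsP-swap : ∀ {p} → IsP a b p → IsP a b (swap p)
  IsN-swap : ∀ {p} → IsN a b p → IsN a b (swap p)
  IsP-swap (isP N-options) = isP λ q mv → IsN-swap (N-options (swap q) (Move-swap mv))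
  IsN-swap (isN q mv q-P) = isN (swap q) (Move-swap mv) (IsP-swap q-P)

  IsP⇒¬IsN : ∀ {p} → IsP a b p → ¬ IsN a b p
  IsP⇒¬IsN (isP N-options) (isN q mv q-P) = IsP⇒¬IsN q-P (N-options q mv)

  P-move⇒N : ∀ {p q} → IsP a b p → Move a b p q → IsN a b q
  P-move⇒N (isP N-options) = N-options _

  IsP-or-IsN : ∀ p → IsP a b p ⊎ IsN a b p
  IsP-or-IsN = WF.All.wfRec (wellFounded size <-wellFounded) _ _ decide
    where
    decide : ∀ p → (∀ {q} → size q < size p → IsP a b q ⊎ IsN a b q) → IsP a b p ⊎ IsN a b p
    decide p rec with P-or-all-Q (moves a b p) (rec ∘ ∈moves⇒size< p)
    ... | inj₁ (q , q∈ , q-P) = inj₂ (isN q (∈moves⇒Move p q∈) q-P)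
    ... | inj₂ all-N = inj₁ (isP λ q mv → All.lookup all-N (Move⇒∈moves mv))

  P-separated : ∀ {p q} → IsP a b p → IsP a b q → q ⊏ p
              → ¬ Allowed (proj₁ p ∸ proj₁ q) (proj₂ p ∸ proj₂ q)
  P-separated p-P q-P q⊏p allowed = IsP⇒¬IsN q-P (P-move⇒N p-P (Allowed⇒Move q⊏p allowed))

  ¬Allowed⇒b≤ : ∀ {e d} → ¬ Allowed e d → b ≤ e
  ¬Allowed⇒b≤ {e} {d} ¬allowed = ≤-trans (≮⇒≥ (¬allowed ∘ inj₂)) (m⊓n≤m e d)

  gap⇒¬Allowed : ∀ {e d} → b ≤ e → e + a ≤ d → ¬ Allowed e d
  gap⇒¬Allowed {e} {d} b≤e e+a≤d (inj₁ ∣e-d∣<a) =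
    <⇒≱ ∣e-d∣<a (subst (a ≤_) (sym (m≤n⇒∣m-n∣≡n∸m (m+n≤o⇒m≤o e e+a≤d)))
      (m+n≤o⇒m≤o∸n a (subst (_≤ d) (+-comm e a) e+a≤d)))
  gap⇒¬Allowed {e} {d} b≤e e+a≤d (inj₂ e⊓d<b) =
    <⇒≱ e⊓d<b (subst (b ≤_) (sym (m≤n⇒m⊓n≡m (m+n≤o⇒m≤o e e+a≤d))) b≤e)

  remF-stable : ∀ {k k′} p → size p < k → size p < k′ → remF a b k p ≡ remF a b k′ p
  remF-stable {suc k} {suc k′} p p<k p<k′ =
    cong combine (map-cong-local {f = remF a b k} {g = remF a b k′} {xs = moves a b p} (All.tabulate λ q∈ →
      let q<p = ∈moves⇒size< p q∈ in
      remF-stable _ (<-≤-trans q<p (≤-pred p<k)) (<-≤-trans q<p (≤-pred p<k′))))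

  Rem-unfold : ∀ p → Rem a b p ≡ combine (map (Rem a b) (moves a b p))
  Rem-unfold p =
    cong combine (map-cong-local {f = remF a b (size p)} {g = Rem a b} {xs = moves a b p} (All.tabulate λ q∈ →
      remF-stable _ (∈moves⇒size< p q∈) ≤-refl))

  IsP⇒Rem-Even : ∀ {p} → IsP a b p → Even (Rem a b p)
  IsN⇒Rem-Odd : ∀ {p} → IsN a b p → Odd (Rem a b p)
  IsP⇒Rem-Even {p} (isP N-options) rewrite Rem-unfold p =
    combine-odd-Even (map⁺ (All.tabulate λ q∈ → IsN⇒Rem-Odd (N-options _ (∈moves⇒Move p q∈))))
  IsN⇒Rem-Odd {p} (isN q mv q-P) rewrite Rem-unfold p =
    combine-even-Odd (∈-map⁺ (Rem a b) (Move⇒∈moves mv)) (IsP⇒Rem-Even q-P)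

  options-Odd : ∀ {p} → IsP a b p → All Odd (map (Rem a b) (moves a b p))
  options-Odd {p} p-P = map⁺ (All.tabulate λ q∈ → IsN⇒Rem-Odd (P-move⇒N p-P (∈moves⇒Move p q∈)))

  Rem-P-≤ : ∀ {p k} → IsP a b p → (∀ {q} → Move a b p q → suc (Rem a b q) ≤ k) → Rem a b p ≤ k
  Rem-P-≤ {p} p-P bound rewrite Rem-unfold p =
    combine-odd-≤ (options-Odd p-P) (map⁺ (All.tabulate (bound ∘ ∈moves⇒Move p)))

  Rem-P-≥ : ∀ {p q} → IsP a b p → Move a b p q → suc (Rem a b q) ≤ Rem a b p
  Rem-P-≥ {p} p-P mv rewrite Rem-unfold p =
    combine-odd-≥ (options-Odd p-P) (∈-map⁺ (Rem a b) (Move⇒∈moves mv))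

  Rem-≤-P-option : ∀ {q r} → Move a b q r → IsP a b r → Rem a b q ≤ suc (Rem a b r)
  Rem-≤-P-option {q} mv r-P rewrite Rem-unfold q =
    combine-even-≤ (∈-map⁺ (Rem a b) (Move⇒∈moves mv)) (IsP⇒Rem-Even r-P)

  Rem-N-attained : ∀ {q} → IsN a b q
                 → ∃ λ r → Move a b q r × IsP a b r × Rem a b q ≡ suc (Rem a b r)
  Rem-N-attained {q} (isN r mv r-P)
    with m , ≡suc , m∈ , m-even , _ ←
           combine-even (∈-map⁺ (Rem a b) (Move⇒∈moves mv)) (IsP⇒Rem-Even r-P)
    with r′ , r′∈ , refl ← ∈-map⁻ (Rem a b) m∈
    = r′ , ∈moves⇒Move q r′∈ , Even⇒IsP (IsP-or-IsN r′) , trans (Rem-unfold q) ≡suc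
    where
    Even⇒IsP : IsP a b r′ ⊎ IsN a b r′ → IsP a b r′
    Even⇒IsP (inj₁ r′-P) = r′-P
    Even⇒IsP (inj₂ r′-N) = ⊥-elim (Even⇒¬Odd {Rem a b r′} m-even (IsN⇒Rem-Odd r′-N))

module PPositions (a b : ℕ) (1≤a : 1 ≤ a) (1≤b : 1 ≤ b) (f : ℕ → Pos)
  (f-P : ∀ m → IsP a b (f m)) (f-≤ : ∀ m → proj₁ (f m) ≤ proj₂ (f m))
  (f-mono : ∀ m → proj₁ (f m) < proj₁ (f (suc m)))
  (f-complete : ∀ x y → IsP a b (x , y) → x ≤ y → ∃ λ m → f m ≡ (x , y)) where

  open WYT a b

  X Y : ℕ → ℕ
  X m = proj₁ (f m)
  Y m = proj₂ (f m)

  Indexed : Pos → ℕ → Set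
  Indexed p m = p ≡ f m ⊎ p ≡ swap (f m)

  X-<-mono : ∀ {j k} → j < k → X j < X k
  X-<-mono {j} {suc k} j<1+k with m<1+n⇒m<n∨m≡n j<1+k
  ... | inj₁ j<k = <-trans (X-<-mono j<k) (f-mono k)
  ... | inj₂ refl = f-mono k

  X-cancel-≤ : ∀ {j k} → X j ≤ X k → j ≤ k
  X-cancel-≤ Xj≤Xk = ≮⇒≥ λ k<j → <⇒≱ (X-<-mono k<j) Xj≤Xk

  Indexed⇒IsP : ∀ {p m} → Indexed p m → IsP a b p
  Indexed⇒IsP (inj₁ refl) = f-P _
  Indexed⇒IsP (inj₂ refl) = IsP-swap (f-P _)

  IsP⇒Indexed : ∀ {p} → IsP a b p → ∃ (Indexed p)
  IsP⇒Indexed {x , y} p-P with x ≤? y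
  ... | yes x≤y = let m , fm≡p = f-complete x y p-P x≤y in m , inj₁ (sym fm≡p)
  ... | no x≰y =
    let m , fm≡p = f-complete y x (IsP-swap p-P) (<⇒≤ (≰⇒> x≰y)) in m , inj₂ (sym (cong swap fm≡p))

  Indexed-swap : ∀ {p m} → Indexed p m → Indexed (swap p) m
  Indexed-swap (inj₁ refl) = inj₂ refl
  Indexed-swap (inj₂ refl) = inj₁ refl

  Indexed-⊓ : ∀ {p m} → Indexed p m → proj₁ p ⊓ proj₂ p ≡ X m
  Indexed-⊓ {m = m} (inj₁ refl) = m≤n⇒m⊓n≡m (f-≤ m)
  Indexed-⊓ {m = m} (inj₂ refl) = trans (⊓-comm (Y m) (X m)) (m≤n⇒m⊓n≡m (f-≤ m))

  Indexed-size : ∀ {p m} → Indexed p m → size p ≡ X m + Y m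
  Indexed-size (inj₁ refl) = refl
  Indexed-size {m = m} (inj₂ refl) = +-comm (Y m) (X m)

  Indexed-proj₂≤Y : ∀ {p m} → Indexed p m → proj₂ p ≤ Y m
  Indexed-proj₂≤Y (inj₁ refl) = ≤-refl
  Indexed-proj₂≤Y (inj₂ refl) = f-≤ _

  Indexed-⊏⇒< : ∀ {p q m j} → q ⊏ p → Indexed p m → Indexed q j → j < m
  Indexed-⊏⇒< (q₁≤p₁ , q₂≤p₂ , q<p) ip iq
    with m≤n⇒m<n∨m≡n (X-cancel-≤ (subst₂ _≤_ (Indexed-⊓ iq) (Indexed-⊓ ip) (⊓-mono-≤ q₁≤p₁ q₂≤p₂)))
  ... | inj₁ j<m = j<m
  ... | inj₂ refl = ⊥-elim (<-irrefl (trans (Indexed-size iq) (sym (Indexed-size ip))) q<p)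

  OnDiagonal : ℕ → Set
  OnDiagonal m = Y m ≡ X m + a * m

  Indexed-proj₂≤proj₁+a* : ∀ {p m} → OnDiagonal m → Indexed p m → proj₂ p ≤ proj₁ p + a * m
  Indexed-proj₂≤proj₁+a* on-diag (inj₁ refl) = ≤-reflexive on-diag
  Indexed-proj₂≤proj₁+a* {m = m} _ (inj₂ refl) = ≤-trans (f-≤ m) (m≤m+n (Y m) (a * m))

  earlier-unreachable : ∀ {n y r j} → (∀ {i} → i < n → OnDiagonal i)
                      → X n + a * n ≤ Y n → X n + a * n ≤ y
                      → Move a b (X n , y) r → Indexed r j → ¬ j < n
  -- The first decrement is ≥ b because r and f n are distinct P-positions; by the slopes of the
  -- diagonals, the second decrement exceeds the first by at least a.
  earlier-unreachable {n} {y} {r} {j} on-diag Yn-large y-large mv ir j<n =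
    gap⇒¬Allowed b≤e e+a≤d (Move⇒Allowed mv)
    where
    open ≤-Reasoning
    r₁≤Xn = proj₁ (Move⇒⊏ mv)
    r₂≤y = proj₁ (proj₂ (Move⇒⊏ mv))
    r₂<Yn : proj₂ r < Y n
    r₂<Yn = begin-strict
      proj₂ r     ≤⟨ Indexed-proj₂≤Y ir ⟩
      Y j         ≡⟨ on-diag j<n ⟩
      X j + a * j <⟨ +-mono-<-≤ (X-<-mono j<n) (*-monoʳ-≤ a (<⇒≤ j<n)) ⟩
      X n + a * n ≤⟨ Yn-large ⟩
      Y n         ∎
    b≤e : b ≤ X n ∸ proj₁ r
    b≤e = ¬Allowed⇒b≤
      (P-separated (f-P n) (Indexed⇒IsP ir) (r₁≤Xn , <⇒≤ r₂<Yn , +-mono-≤-< r₁≤Xn r₂<Yn))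
    shuffle : ∀ x c r k → x + c + (r + c * k) ≡ x + c * suc k + r
    shuffle = solve-∀
    e+a≤d : (X n ∸ proj₁ r) + a ≤ y ∸ proj₂ r
    e+a≤d = ∸-gap a r₁≤Xn r₂≤y (begin
      X n + a + proj₂ r             ≤⟨ +-monoʳ-≤ (X n + a) (Indexed-proj₂≤proj₁+a* (on-diag j<n) ir) ⟩
      X n + a + (proj₁ r + a * j)   ≡⟨ shuffle (X n) a (proj₁ r) j ⟩
      X n + a * suc j + proj₁ r     ≤⟨ +-monoˡ-≤ (proj₁ r) (+-monoʳ-≤ (X n) (*-monoʳ-≤ a j<n)) ⟩
      X n + a * n + proj₁ r         ≤⟨ +-monoˡ-≤ (proj₁ r) y-large ⟩
      y + proj₁ r                   ∎)

  not-below-diagonal : ∀ {n} → (∀ {i} → i < n → OnDiagonal i) → ¬ Y n < X n + a * n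
  -- With d = y_n − x_n and k = ⌊d/a⌋, the P-positions f n and f k differ by (e, e + d mod a).
  not-below-diagonal {n} on-diag Yn-small =
    P-separated (f-P n) (f-P k) (<⇒≤ Xk<Xn , Yk≤Yn , +-mono-<-≤ Xk<Xn Yk≤Yn) (inj₁ ∣e-d∣<a)
    where
    instance
      a≢0 : NonZero a
      a≢0 = >-nonZero 1≤a
    d = Y n ∸ X n
    k = d / a
    Yn≡Xn+d : Y n ≡ X n + d
    Yn≡Xn+d = sym (m+[n∸m]≡n (f-≤ n))
    k<n : k < n
    k<n = m<n*o⇒m/o<n (subst (d <_) (*-comm a n)
            (+-cancelˡ-< (X n) d (a * n) (subst (_< X n + a * n) Yn≡Xn+d Yn-small)))
    Xk<Xn = X-<-mono k<n
    e = X n ∸ X k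
    shuffle : ∀ x e r q → (x + e) + (r + q) ≡ (x + q) + (e + r)
    shuffle = solve-∀
    Yn≡Yk+e+d%a : Y n ≡ Y k + (e + d % a)
    Yn≡Yk+e+d%a = begin
      Y n                             ≡⟨ Yn≡Xn+d ⟩
      X n + d                         ≡⟨ cong₂ _+_ (m+[n∸m]≡n (<⇒≤ Xk<Xn)) (sym (m≡m%n+[m/n]*n d a)) ⟨
      (X k + e) + (d % a + k * a)     ≡⟨ shuffle (X k) e (d % a) (k * a) ⟩
      (X k + k * a) + (e + d % a)     ≡⟨ cong (λ t → X k + t + (e + d % a)) (*-comm k a) ⟩
      (X k + a * k) + (e + d % a)     ≡⟨ cong (_+ (e + d % a)) (on-diag k<n) ⟨
      Y k + (e + d % a)               ∎
      where open ≡-Reasoning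
    Yk≤Yn : Y k ≤ Y n
    Yk≤Yn = subst (Y k ≤_) (sym Yn≡Yk+e+d%a) (m≤m+n (Y k) (e + d % a))
    ∣e-d∣<a : ∣ e - Y n ∸ Y k ∣ < a
    ∣e-d∣<a = begin-strict
      ∣ e - Y n ∸ Y k ∣                 ≡⟨ cong (λ t → ∣ e - t ∸ Y k ∣) Yn≡Yk+e+d%a ⟩
      ∣ e - Y k + (e + d % a) ∸ Y k ∣   ≡⟨ cong ∣ e -_∣ (m+n∸m≡n (Y k) (e + d % a)) ⟩
      ∣ e - e + d % a ∣                 ≡⟨ ∣m-m+n∣≡n e (d % a) ⟩
      d % a                             <⟨ m%n<n d a ⟩
      a                                 ∎
      where open ≤-Reasoning

  not-above-diagonal : ∀ {n} → (∀ {i} → i < n → OnDiagonal i) → ¬ X n + a * n < Y n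
  not-above-diagonal {n} on-diag Yn-large = refute (IsP-or-IsN w)
    where
    w : Pos
    w = X n , X n + a * n
    w⊏fn : w ⊏ f n
    w⊏fn = ≤-refl , <⇒≤ Yn-large , +-monoʳ-< (X n) Yn-large
    refute : IsP a b w ⊎ IsN a b w → ⊥
    refute (inj₁ w-P) =
      P-separated (f-P n) w-P w⊏fn
        (inj₂ (subst (λ t → t ⊓ (Y n ∸ proj₂ w) < b) (sym (n∸n≡0 (X n))) 1≤b))
    refute (inj₂ (isN r mv r-P)) =
      let j , ir = IsP⇒Indexed r-P in
      earlier-unreachable on-diag (<⇒≤ Yn-large) ≤-refl mv ir
        (Indexed-⊏⇒< (⊏-trans (Move⇒⊏ mv) w⊏fn) (inj₁ refl) ir)

  on-diagonal : ∀ n → OnDiagonal n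
  on-diagonal = <-rec OnDiagonal step
    where
    step : ∀ n → (∀ {i} → i < n → OnDiagonal i) → OnDiagonal n
    step n on-diag with <-cmp (Y n) (X n + a * n)
    ... | tri< below _ _ = ⊥-elim (not-below-diagonal on-diag below)
    ... | tri≈ _ on _ = on
    ... | tri> _ _ above = ⊥-elim (not-above-diagonal on-diag above)

  late-option : ∀ {n p} → Indexed p (suc n)
              → ∃ λ q → Move a b p q × (∀ {r j} → Move a b q r → Indexed r j → n ≤ j)
  late-option {n} (inj₁ refl) = q , Allowed⇒Move q⊏ (inj₂ e⊓0<b) , λ mv ir →
    ≮⇒≥ (earlier-unreachable (λ _ → on-diagonal _) (≤-reflexive (sym (on-diagonal n))) y-large mv ir)
    where
    open ≤-Reasoning
    q : Pos
    q = X n , Y (suc n)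
    q⊏ : q ⊏ f (suc n)
    q⊏ = <⇒≤ (f-mono n) , ≤-refl , +-monoˡ-< (Y (suc n)) (f-mono n)
    e⊓0<b : (X (suc n) ∸ X n) ⊓ (Y (suc n) ∸ Y (suc n)) < b
    e⊓0<b rewrite n∸n≡0 (Y (suc n)) | ⊓-zeroʳ (X (suc n) ∸ X n) = 1≤b
    y-large : X n + a * n ≤ Y (suc n)
    y-large = begin
      X n + a * n             ≤⟨ +-mono-≤ (<⇒≤ (f-mono n)) (*-monoʳ-≤ a (n≤1+n n)) ⟩
      X (suc n) + a * suc n   ≡⟨ on-diagonal (suc n) ⟨
      Y (suc n)               ∎
  late-option (inj₂ refl) =
    let q , mv , late = late-option (inj₁ refl) in
    swap q , Move-swap mv , λ mv′ ir → late (Move-swap mv′) (Indexed-swap ir)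

  option-reaches-earlier : ∀ {m p q} → Indexed p m → Move a b p q
                         → ∃ λ r → ∃ λ j → Move a b q r × Indexed r j × j < m
  option-reaches-earlier ip p→q with isN r q→r r-P ← P-move⇒N (Indexed⇒IsP ip) p→q =
    let j , ir = IsP⇒Indexed r-P in
    r , j , q→r , ir , Indexed-⊏⇒< (⊏-trans (Move⇒⊏ q→r) (Move⇒⊏ p→q)) ip ir

  RemFormula : ℕ → Set
  RemFormula m = ∀ {p} → Indexed p m → Rem a b p ≡ 2 * m

  Rem-indexed-≤ : ∀ {m p} → (∀ {j} → j < m → RemFormula j) → Indexed p m → Rem a b p ≤ 2 * m
  Rem-indexed-≤ {m} {p} IH ip = Rem-P-≤ (Indexed⇒IsP ip) option-bound
    where
    open ≤-Reasoning
    option-bound : ∀ {q} → Move a b p q → suc (Rem a b q) ≤ 2 * m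
    option-bound {q} p→q =
      let r , j , q→r , ir , j<m = option-reaches-earlier ip p→q in begin
      suc (Rem a b q)         ≤⟨ s≤s (Rem-≤-P-option q→r (Indexed⇒IsP ir)) ⟩
      suc (suc (Rem a b r))   ≡⟨ cong (suc ∘ suc) (IH j<m ir) ⟩
      suc (suc (2 * j))       ≡⟨ *-suc 2 j ⟨
      2 * suc j               ≤⟨ *-monoʳ-≤ 2 j<m ⟩
      2 * m                   ∎

  Rem-indexed-≥ : ∀ {m p} → (∀ {j} → j < m → RemFormula j) → Indexed p m → 2 * m ≤ Rem a b p
  Rem-indexed-≥ {zero} _ _ = z≤n
  Rem-indexed-≥ {suc n} {p} IH ip
    with q , p→q , late ← late-option ip
    with r , q→r , r-P , Rem-q≡ ← Rem-N-attained (P-move⇒N (Indexed⇒IsP ip) p→q)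
    with j , ir ← IsP⇒Indexed r-P
    with refl ← ≤-antisym (late q→r ir)
                          (≤-pred (Indexed-⊏⇒< (⊏-trans (Move⇒⊏ q→r) (Move⇒⊏ p→q)) ip ir))
    = begin
      2 * suc n               ≡⟨ *-suc 2 n ⟩
      suc (suc (2 * n))       ≡⟨ cong (suc ∘ suc) (IH ≤-refl ir) ⟨
      suc (suc (Rem a b r))   ≡⟨ cong suc Rem-q≡ ⟨
      suc (Rem a b q)         ≤⟨ Rem-P-≥ (Indexed⇒IsP ip) p→q ⟩
      Rem a b p               ∎
    where open ≤-Reasoning

  Rem-indexed : ∀ m → RemFormula m
  Rem-indexed = <-rec RemFormula λ m IH ip → ≤-antisym (Rem-indexed-≤ IH ip) (Rem-indexed-≥ IH ip)

mainTheorem13 : (a b : ℕ) → 1 ≤ a → 1 ≤ b → (f : ℕ → Pos)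
    → (∀ m → IsP a b (f m))
    → (∀ m → proj₁ (f m) ≤ proj₂ (f m))
    → (∀ m → proj₁ (f m) < proj₁ (f (suc m)))
    → (∀ x y → IsP a b (x , y) → x ≤ y → ∃ λ m → f m ≡ (x , y))
    → ∀ m → Rem a b (f m) ≡ 2 * m
mainTheorem13 a b 1≤a 1≤b f f-P f-≤ f-mono f-complete m = Rem-indexed m (inj₁ refl)
  where open PPositions a b 1≤a 1≤b f f-P f-≤ f-mono f-complete
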